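{- For any integers $n\geq 1$ and $0\leq k\leq n-1$, the number of ordered preference sets of length $n$ with exactly $k$ flaws is $op_{n,k}=\frac{k+1}{n}\binom{2n}{n-k-1}$.
   Context: Parking model: $n$ parking spaces numbered $1,\dots,n$ from left to right; a preference set of length $n$ is a sequence $(a_1,\dots,a_n)$ with $a_i\in[n]$. Cars arrive in order; car $i$ goes to space $a_i$, and if it is occupied, moves to the first unoccupied space to the right; if there is none, the car cannot park. The number of flaws is the number of cars that cannot park. A preference set is ordered if $a_1\leq\cdots\leq a_n$. -}

module Defs where

open import Data.Nat using (ℕ; zero; suc; _+_; _≤ᵇ_; _≡ᵇ_)
open import Data.Bool using (Bool; true; false; _∧_; not)
open import Data.Product using (_×_; _,_)
open import Data.Fin using (Fin; toℕ)
open import Data.Vec using (Vec; []; _∷_; replicate)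
open import Data.List using (List; []; _∷_; concatMap; map; length; filterᵇ; allFin)

-- Spaces 1..n are represented by Fin n (space toℕ i + 1).
-- A preference set of length n is a sequence (a_1,…,a_n) with a_i ∈ [n].
PrefSet : ℕ → Set
PrefSet n = Vec (Fin n) n

-- Occupancy vector of the lot (true = occupied), spaces left to right.
-- parkAt d occ: a car whose preferred space is at offset d within occ.
parkAt : {m : ℕ} → ℕ → Vec Bool m → Vec Bool m × Bool
parkAt d [] = [] , false
parkAt zero (false ∷ occ) = true ∷ occ , true
parkAt zero (true ∷ occ) with parkAt zero occ
... | occ' , b = true ∷ occ' , b
parkAt (suc d) (o ∷ occ) with parkAt d occ
... | occ' , b = o ∷ occ' , b

flawsFrom : {m k : ℕ} → Vec Bool m → Vec (Fin m) k → ℕ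
flawsFrom occ [] = 0
flawsFrom occ (a ∷ as) with parkAt (toℕ a) occ
... | occ' , true  = flawsFrom occ' as
... | occ' , false = suc (flawsFrom occ' as)

flaws : {n : ℕ} → PrefSet n → ℕ
flaws {n} a = flawsFrom (replicate n false) a

orderedᵇ : {m k : ℕ} → Vec (Fin m) k → Bool
orderedᵇ [] = true
orderedᵇ (a ∷ []) = true
orderedᵇ (a ∷ b ∷ as) = (toℕ a ≤ᵇ toℕ b) ∧ orderedᵇ (b ∷ as)

allVecs : (m k : ℕ) → List (Vec (Fin m) k)
allVecs m zero = [] ∷ []
allVecs m (suc k) = concatMap (λ a → map (a ∷_) (allVecs m k)) (allFin m)

op : ℕ → ℕ → ℕ
op n k = length (filterᵇ (λ a → orderedᵇ a ∧ (flaws a ≡ᵇ k)) (allVecs n n))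

-- In an ordered run the occupied spaces from the latest preferred space onwards
-- form one block starting at that space, so the state of the lot is just the
-- pair (spaces from there on, occupied among them).  Continuations with at most
-- t flaws then correspond to lattice paths whose height, the spare capacity
-- "free spaces + allowed flaws - cars to come", never becomes negative.  For
-- ordered preference sets of length n the reflection principle counts these as
-- C(2n-1, n-1) - C(2n-1, n-t-2), so differencing in t gives
-- op n t = C(2n-1, n-t-1) - C(2n-1, n-t-2) = (t+1)/n * C(2n, n-t-1).
module Submission where

open import Defs
open import Data.Nat using (ℕ; zero; suc; _+_; _*_; _∸_; _≤_; _<_; z≤n; s≤s; _<ᵇ_; _≤ᵇ_; _≡ᵇ_)
open import Data.Nat.Properties
open import Data.Nat.Combinatorics using (_C_; nCn≡1; nCk+nC[k+1]≡[n+1]C[k+1])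
open import Data.Nat.ListAction using (sum)
open import Data.Nat.Solver using (module +-*-Solver)
open import Data.Bool using (Bool; true; false; if_then_else_; _∧_)
open import Data.Bool.Properties using (∧-assoc; if-eta; if-cong₂)
open import Data.Empty using (⊥-elim)
open import Data.Fin using (Fin; toℕ)
open import Data.Vec using (Vec; []; _∷_; replicate)
open import Data.List using (List; []; _∷_; _++_; concatMap; map; length; filterᵇ; allFin; tabulate)
open import Data.List.Properties using (map-cong; map-tabulate)
open import Data.Product using (_,_; proj₁; proj₂)
open import Function using (_∘_; id)
open import Relation.Nullary.Reflects using (ofʸ; ofⁿ)
open import Relation.Binary.PropositionalEquality
open +-*-Solver using (solve; _:+_; _:*_; _:=_; con)
open ≡-Reasoning

paths : ℕ → ℕ → ℕ
paths zero    b       = 1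
paths (suc a) zero    = 1
paths (suc a) (suc b) = paths a (suc b) + paths (suc a) b

paths≡C : ∀ a b → paths a b ≡ (a + b) C b
paths≡C zero    b       = sym (nCn≡1 b)
paths≡C (suc a) zero    = refl
paths≡C (suc a) (suc b) = begin
  paths a (suc b) + paths (suc a) b              ≡⟨ cong₂ _+_ (paths≡C a (suc b)) (paths≡C (suc a) b) ⟩
  (a + suc b) C suc b + suc (a + b) C b          ≡⟨ cong (λ x → x C suc b + suc (a + b) C b) (+-suc a b) ⟩
  suc (a + b) C suc b + suc (a + b) C b          ≡⟨ +-comm (suc (a + b) C suc b) _ ⟩
  suc (a + b) C b + suc (a + b) C suc b          ≡⟨ nCk+nC[k+1]≡[n+1]C[k+1] (suc (a + b)) b ⟩
  suc (suc (a + b)) C suc b                      ≡⟨ cong (λ x → suc x C suc b) (+-suc a b) ⟨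
  suc (a + suc b) C suc b                        ∎

paths-1ˡ : ∀ b → paths 1 b ≡ suc b
paths-1ˡ zero    = refl
paths-1ˡ (suc b) = cong suc (paths-1ˡ b)

paths-1ʳ : ∀ a → paths a 1 ≡ suc a
paths-1ʳ zero    = refl
paths-1ʳ (suc a) = trans (cong (_+ 1) (paths-1ʳ a)) (+-comm (suc a) 1)

paths-absorb : ∀ a b → suc b * paths a (suc b) ≡ suc a * paths (suc a) b
paths-absorb zero    b       = trans (*-identityʳ (suc b)) (sym (trans (+-identityʳ _) (paths-1ˡ b)))
paths-absorb (suc a) zero    = trans (+-identityʳ _) (trans (paths-1ʳ (suc a)) (sym (*-identityʳ _)))
paths-absorb (suc a) (suc b) = begin
  suc (suc b) * (paths a (suc (suc b)) + X)          ≡⟨ *-distribˡ-+ (suc (suc b)) (paths a (suc (suc b))) X ⟩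
  suc (suc b) * paths a (suc (suc b)) + (X + suc b * X)
    ≡⟨ cong₂ (λ u v → u + (X + v)) (paths-absorb a (suc b)) (paths-absorb (suc a) b) ⟩
  suc a * X + (X + suc (suc a) * Y)
    ≡⟨ solve 3 (λ a X Y → (con 1 :+ a) :* X :+ (X :+ (con 2 :+ a) :* Y) := (con 2 :+ a) :* (X :+ Y)) refl a X Y ⟩
  suc (suc a) * (X + Y)                              ∎
  where
  X = paths (suc a) (suc b)
  Y = paths (suc (suc a)) b

-- Lattice paths from (k , d) to the origin along which the height h, raised
-- by each k-step and lowered by each d-step, never becomes negative.
boundedPaths : ℕ → ℕ → ℕ → ℕ
boundedPaths k       zero    h       = 1
boundedPaths zero    (suc d) zero    = 0
boundedPaths zero    (suc d) (suc h) = boundedPaths zero d h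
boundedPaths (suc k) (suc d) zero    = boundedPaths k (suc d) 1
boundedPaths (suc k) (suc d) (suc h) = boundedPaths k (suc d) (suc (suc h)) + boundedPaths (suc k) d h

boundedPaths-unconstrained : ∀ k d h → d ≤ h → boundedPaths k d h ≡ paths k d
boundedPaths-unconstrained zero    zero    h       _         = refl
boundedPaths-unconstrained (suc k) zero    h       _         = refl
boundedPaths-unconstrained zero    (suc d) (suc h) (s≤s d≤h) = boundedPaths-unconstrained zero d h d≤h
boundedPaths-unconstrained (suc k) (suc d) (suc h) (s≤s d≤h) =
  cong₂ _+_ (boundedPaths-unconstrained k (suc d) (suc (suc h)) (m≤n⇒m≤1+n (s≤s d≤h)))
            (boundedPaths-unconstrained (suc k) d h d≤h)

boundedPaths-blocked : ∀ d h → h < d → boundedPaths zero d h ≡ 0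
boundedPaths-blocked (suc d) zero    _         = refl
boundedPaths-blocked (suc d) (suc h) (s≤s h<d) = boundedPaths-blocked d h h<d

-- Reflection principle: reflecting the part of a path from (k , h+e+1) before
-- it first reaches height -1 gives the paths from (k+h+1 , e).
reflection : ∀ k h e → e ≤ k →
  boundedPaths k (suc (h + e)) h + paths (suc (h + k)) e ≡ paths k (suc (h + e))
reflection zero    h       zero    _         = cong (_+ 1) (boundedPaths-blocked (suc (h + 0)) h (s≤s (m≤m+n h 0)))
reflection (suc k) zero    zero    _         = cong (_+ 1) (boundedPaths-unconstrained k 1 1 (s≤s z≤n))
reflection (suc k) zero    (suc e) (s≤s e≤k) = begin
  boundedPaths k (suc (suc e)) 1 + (paths (suc k) (suc e) + paths (suc (suc k)) e)
    ≡⟨ x+[y+z]≡[x+z]+y (boundedPaths k (suc (suc e)) 1) (paths (suc k) (suc e)) (paths (suc (suc k)) e) ⟩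
  (boundedPaths k (suc (suc e)) 1 + paths (suc (suc k)) e) + paths (suc k) (suc e)
    ≡⟨ cong (_+ paths (suc k) (suc e)) (reflection k 1 e e≤k) ⟩
  paths k (suc (suc e)) + paths (suc k) (suc e) ∎
  where
  x+[y+z]≡[x+z]+y : ∀ x y z → x + (y + z) ≡ (x + z) + y
  x+[y+z]≡[x+z]+y = solve 3 (λ x y z → x :+ (y :+ z) := (x :+ z) :+ y) refl
reflection (suc k) (suc h) zero    _         = begin
  boundedPaths k (suc (suc (h + 0))) (suc (suc h)) + boundedPaths (suc k) (suc (h + 0)) h + 1
    ≡⟨ +-assoc (boundedPaths k (suc (suc (h + 0))) (suc (suc h))) _ 1 ⟩
  boundedPaths k (suc (suc (h + 0))) (suc (suc h)) + (boundedPaths (suc k) (suc (h + 0)) h + 1)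
    ≡⟨ cong₂ _+_ (boundedPaths-unconstrained k _ _ (s≤s (s≤s (≤-reflexive (+-identityʳ h)))))
                 (reflection (suc k) h zero z≤n) ⟩
  paths k (suc (suc (h + 0))) + paths (suc k) (suc (h + 0)) ∎
reflection (suc k) (suc h) (suc e) (s≤s e≤k) = begin
  (B₁ + B₂) + (P₂ + P₁)   ≡⟨ regroup B₁ B₂ P₂ P₁ ⟩
  (B₁ + P₁) + (B₂ + P₂)   ≡⟨ cong₂ _+_ shifted (reflection (suc k) h (suc e) (s≤s e≤k)) ⟩
  paths k (suc (suc (h + suc e))) + paths (suc k) (suc (h + suc e)) ∎
  where
  B₁ = boundedPaths k (suc (suc (h + suc e))) (suc (suc h))
  B₂ = boundedPaths (suc k) (suc (h + suc e)) h
  P₁ = paths (suc (suc (h + suc k))) e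
  P₂ = paths (suc (h + suc k)) (suc e)
  regroup : ∀ a b c d → (a + b) + (c + d) ≡ (a + d) + (b + c)
  regroup = solve 4 (λ a b c d → (a :+ b) :+ (c :+ d) := (a :+ d) :+ (b :+ c)) refl
  shifted : B₁ + P₁ ≡ paths k (suc (suc (h + suc e)))
  shifted rewrite +-suc h e | +-suc h k = reflection k (suc (suc h)) e e≤k

sumBelow : ℕ → (ℕ → ℕ) → ℕ
sumBelow zero    f = 0
sumBelow (suc n) f = f 0 + sumBelow n (f ∘ suc)

sumBelow-cong : ∀ n {f g : ℕ → ℕ} → (∀ d → d < n → f d ≡ g d) → sumBelow n f ≡ sumBelow n g
sumBelow-cong zero    f≡g = refl
sumBelow-cong (suc n) f≡g = cong₂ _+_ (f≡g 0 (s≤s z≤n)) (sumBelow-cong n (λ d d<n → f≡g (suc d) (s≤s d<n)))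

sumBelow-+ : ∀ n (f g : ℕ → ℕ) → sumBelow n (λ d → f d + g d) ≡ sumBelow n f + sumBelow n g
sumBelow-+ zero    f g = refl
sumBelow-+ (suc n) f g = trans (cong (f 0 + g 0 +_) (sumBelow-+ n (f ∘ suc) (g ∘ suc)))
                               (interchange (f 0) (g 0) _ _)
  where
  interchange : ∀ a b c d → (a + b) + (c + d) ≡ (a + c) + (b + d)
  interchange = solve 4 (λ a b c d → (a :+ b) :+ (c :+ d) := (a :+ c) :+ (b :+ d)) refl

sumBelow-zero : ∀ n → sumBelow n (λ _ → 0) ≡ 0
sumBelow-zero zero    = refl
sumBelow-zero (suc n) = sumBelow-zero n

if-<ᵇ-elim : ∀ {r s} {x y z : ℕ} → r ≤ s → (r < s → x ≡ z) → (r ≡ s → y ≡ z) →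
             (if r <ᵇ s then x else y) ≡ z
if-<ᵇ-elim {r} {s} r≤s r<s⇒ r≡s⇒ with r <ᵇ s | <ᵇ-reflects-< r s
... | true  | ofʸ r<s = r<s⇒ r<s
... | false | ofⁿ r≮s = r≡s⇒ (≤∧≮⇒≡ r≤s r≮s)

indicator : Bool → ℕ
indicator true  = 1
indicator false = 0

-- In an ordered run the spaces from the latest preference lo onwards are r
-- occupied spaces followed by free ones, s spaces in all.  completions s r k p
-- counts the ways to continue with k cars preferring lo + d (d < s), such that
-- p holds of the number of further flaws.
completions : ℕ → ℕ → ℕ → (ℕ → Bool) → ℕ
completions s r zero    p = indicator (p 0)
completions s r (suc k) p = sumBelow s λ d →
  if r <ᵇ s then completions (s ∸ d) (suc (r ∸ d)) k p
            else completions (s ∸ d) (r ∸ d) k (p ∘ suc)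

completions-unfold : ∀ s r k p → completions (suc s) r (suc k) p ≡
  (if r <ᵇ suc s then completions (suc s) (suc r) k p else completions (suc s) r k (p ∘ suc))
  + completions s (r ∸ 1) (suc k) p
completions-unfold zero    r       k p = refl
completions-unfold (suc s) (suc r) k p = refl
completions-unfold (suc s) zero    k p =
  cong (completions (suc (suc s)) 1 k p +_)
       (sumBelow-cong (suc s) (λ d _ → cong (λ x → completions (suc s ∸ d) (suc x) k p) (sym (0∸n≡0 d))))

completions-false : ∀ s r k → completions s r k (λ _ → false) ≡ 0
completions-false s r zero    = refl
completions-false s r (suc k) = trans
  (sumBelow-cong s (λ d _ → trans (if-cong₂ (r <ᵇ s) (completions-false (s ∸ d) (suc (r ∸ d)) k)
                                                     (completions-false (s ∸ d) (r ∸ d) k))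
                                  (if-eta (r <ᵇ s))))
  (sumBelow-zero s)

completions-split : ∀ s r k (p q₁ q₂ : ℕ → Bool) →
  (∀ x → indicator (p x) ≡ indicator (q₁ x) + indicator (q₂ x)) →
  completions s r k p ≡ completions s r k q₁ + completions s r k q₂
completions-split s r zero    p q₁ q₂ split = split 0
completions-split s r (suc k) p q₁ q₂ split = trans
  (sumBelow-cong s (λ d _ → trans
     (if-cong₂ (r <ᵇ s) (completions-split (s ∸ d) (suc (r ∸ d)) k p q₁ q₂ split)
                        (completions-split (s ∸ d) (r ∸ d) k (p ∘ suc) (q₁ ∘ suc) (q₂ ∘ suc) (split ∘ suc)))
     (if-+ (r <ᵇ s))))
  (sumBelow-+ s _ _)
  where
  if-+ : ∀ b {x₁ x₂ y₁ y₂ : ℕ} →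
         (if b then x₁ + x₂ else y₁ + y₂) ≡ (if b then x₁ else y₁) + (if b then x₂ else y₂)
  if-+ true  = refl
  if-+ false = refl

atMost : ℕ → ℕ → Bool
atMost t x = x <ᵇ suc t

completions-overfull : ∀ S r k t → r ≤ S → S + t < r + k → completions S r k (atMost t) ≡ 0
completions-overfull S r zero t r≤S S+t<r+0 =
  ⊥-elim (<⇒≱ S+t<r+0 (≤-trans (≤-reflexive (+-identityʳ r)) (≤-trans r≤S (m≤m+n S t))))
completions-overfull zero    r (suc k) t _   _  = refl
completions-overfull (suc s) r (suc k) t r≤S lt = trans (completions-unfold s r k (atMost t))
  (cong₂ _+_ (if-<ᵇ-elim r≤S
               (λ r<S → completions-overfull (suc s) (suc r) k t r<S (subst (suc s + t <_) (+-suc r k) lt))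
               (λ { refl → full t lt }))
             (later r r≤S lt))
  where
  full : ∀ t → suc s + t < suc s + suc k → completions (suc s) (suc s) k (atMost t ∘ suc) ≡ 0
  full zero     _  = completions-false (suc s) (suc s) k
  full (suc t') lt = completions-overfull (suc s) (suc s) k t' ≤-refl
    (+-cancelˡ-< 1 _ _ (subst₂ _<_ (+-suc (suc s) t') (+-suc (suc s) k) lt))
  later : ∀ r → r ≤ suc s → suc s + t < r + suc k → completions s (r ∸ 1) (suc k) (atMost t) ≡ 0
  later zero     _   lt = completions-overfull s 0 (suc k) t z≤n (<-trans (n<1+n (s + t)) lt)
  later (suc r') r≤S lt = completions-overfull s r' (suc k) t (≤-pred r≤S) (+-cancelˡ-< 1 _ _ lt)

-- h = s + 1 + t - k is the spare capacity: spaces left plus flaws allowed,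
-- minus cars to come.
completions-closed : ∀ s r k t h → r ≤ suc s → k + h ≡ suc s + t → r ≤ h →
  completions (suc s) r k (atMost t) ≡ boundedPaths k s h
completions-closed-here : ∀ s r k t h → r ≤ suc s → suc k + h ≡ suc s + t → r ≤ h →
  (if r <ᵇ suc s then completions (suc s) (suc r) k (atMost t)
                 else completions (suc s) r k (atMost t ∘ suc))
  ≡ boundedPaths k s (suc h)
completions-closed-full : ∀ s k t h → suc k + h ≡ suc s + t → suc s ≤ h →
  completions (suc s) (suc s) k (atMost t ∘ suc) ≡ boundedPaths k s (suc h)

completions-closed s r zero t h _ h≡ _ =
  sym (boundedPaths-unconstrained zero s h (≤-trans (n≤1+n s) (≤-trans (m≤m+n (suc s) t) (≤-reflexive (sym h≡)))))
completions-closed zero r (suc k) t h r≤1 eq r≤h = trans (completions-unfold zero r k (atMost t))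
  (trans (+-identityʳ _) (completions-closed-here zero r k t h r≤1 eq r≤h))
completions-closed (suc s) r (suc k) t zero r≤S eq z≤n = trans (completions-unfold (suc s) 0 k (atMost t))
  (trans (cong₂ _+_ (completions-closed-here (suc s) 0 k t 0 r≤S eq z≤n)
                    (completions-overfull (suc s) 0 (suc k) t z≤n
                       (≤-reflexive (sym (trans (cong suc (sym (+-identityʳ k))) eq)))))
         (+-identityʳ _))
completions-closed (suc s) r (suc k) t (suc h) r≤S eq r≤h = trans (completions-unfold (suc s) r k (atMost t))
  (cong₂ _+_ (completions-closed-here (suc s) r k t (suc h) r≤S eq r≤h)
             (completions-closed s (r ∸ 1) (suc k) t h (∸-monoˡ-≤ 1 r≤S)
                (suc-injective (trans (sym (+-suc (suc k) h)) eq)) (∸-monoˡ-≤ 1 r≤h)))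

completions-closed-here s r k t h r≤S eq r≤h = if-<ᵇ-elim r≤S
  (λ r<S → completions-closed s (suc r) k t (suc h) r<S (trans (+-suc k h) eq) (s≤s r≤h))
  (λ { refl → completions-closed-full s k t h eq r≤h })

completions-closed-full s k zero h eq S≤h = ⊥-elim (<⇒≱ (s≤s (m≤n+m h k)) (subst (_≤ h) (sym (trans eq (+-identityʳ (suc s)))) S≤h))
completions-closed-full s k (suc t) h eq S≤h = begin
  completions (suc s) (suc s) k (atMost t)  ≡⟨ completions-closed s (suc s) k t h ≤-refl (suc-injective (trans eq (+-suc (suc s) t))) S≤h ⟩
  boundedPaths k s h                         ≡⟨ boundedPaths-unconstrained k s h s≤h ⟩
  paths k s                                  ≡⟨ boundedPaths-unconstrained k s (suc h) (m≤n⇒m≤1+n s≤h) ⟨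
  boundedPaths k s (suc h)                   ∎
  where
  s≤h = ≤-trans (n≤1+n s) S≤h

count : ∀ {A : Set} → (A → Bool) → List A → ℕ
count p = length ∘ filterᵇ p

count-++ : ∀ {A : Set} (p : A → Bool) xs ys → count p (xs ++ ys) ≡ count p xs + count p ys
count-++ p []       ys = refl
count-++ p (x ∷ xs) ys with p x
... | true  = cong suc (count-++ p xs ys)
... | false = count-++ p xs ys

count-concatMap : ∀ {A B : Set} (p : B → Bool) (f : A → List B) xs →
  count p (concatMap f xs) ≡ sum (map (count p ∘ f) xs)
count-concatMap p f []       = refl
count-concatMap p f (x ∷ xs) =
  trans (count-++ p (f x) (concatMap f xs)) (cong (count p (f x) +_) (count-concatMap p f xs))

count-map : ∀ {A B : Set} (p : B → Bool) (f : A → B) xs → count p (map f xs) ≡ count (p ∘ f) xs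
count-map p f []       = refl
count-map p f (x ∷ xs) with p (f x)
... | true  = cong suc (count-map p f xs)
... | false = count-map p f xs

count-cong : ∀ {A : Set} {p q : A → Bool} → (∀ x → p x ≡ q x) → ∀ xs → count p xs ≡ count q xs
count-cong p≗q []       = refl
count-cong {p = p} {q} p≗q (x ∷ xs) with p x | q x | p≗q x
... | true  | true  | refl = cong suc (count-cong p≗q xs)
... | false | false | refl = count-cong p≗q xs

count-false : ∀ {A : Set} (xs : List A) → count (λ _ → false) xs ≡ 0
count-false []       = refl
count-false (x ∷ xs) = count-false xs

sum-tabulate : ∀ n (g : ℕ → ℕ) → sum (tabulate {n = n} (g ∘ toℕ)) ≡ sumBelow n g
sum-tabulate zero    g = refl
sum-tabulate (suc n) g = cong (g 0 +_) (sum-tabulate n (g ∘ suc))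

count-allVecs-suc : ∀ m k (P : Vec (Fin m) (suc k) → Bool) (G : ℕ → ℕ) →
  (∀ a → count (P ∘ (a ∷_)) (allVecs m k) ≡ G (toℕ a)) →
  count P (allVecs m (suc k)) ≡ sumBelow m G
count-allVecs-suc m k P G byHead = begin
  count P (concatMap (λ a → map (a ∷_) (allVecs m k)) (allFin m))
    ≡⟨ count-concatMap P _ (allFin m) ⟩
  sum (map (λ a → count P (map (a ∷_) (allVecs m k))) (allFin m))
    ≡⟨ cong sum (map-cong (λ a → trans (count-map P (a ∷_) (allVecs m k)) (byHead a)) (allFin m)) ⟩
  sum (map (G ∘ toℕ) (allFin m))
    ≡⟨ cong sum (map-tabulate {n = m} id (G ∘ toℕ)) ⟩
  sum (tabulate {n = m} (G ∘ toℕ))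
    ≡⟨ sum-tabulate m G ⟩
  sumBelow m G ∎

sumBelow-from : ∀ lo m (f : ℕ → ℕ) →
  sumBelow m (λ x → if lo ≤ᵇ x then f x else 0) ≡ sumBelow (m ∸ lo) (f ∘ (lo +_))
sumBelow-from zero          m       f = refl
sumBelow-from (suc lo)      zero    f = refl
sumBelow-from (suc zero)    (suc m) f = sumBelow-from 0 m (f ∘ suc)
sumBelow-from (suc (suc l)) (suc m) f = sumBelow-from (suc l) m (f ∘ suc)

data Packed : (s r : ℕ) → Vec Bool s → Set where
  []    : Packed 0 0 []
  free  : ∀ {s occ}   → Packed s 0 occ → Packed (suc s) 0 (false ∷ occ)
  taken : ∀ {s r occ} → Packed s r occ → Packed (suc s) (suc r) (true ∷ occ)

data PackedFrom : ∀ {m} (lo s r : ℕ) → Vec Bool m → Set where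
  here : ∀ {s r occ} → Packed s r occ → PackedFrom 0 s r occ
  skip : ∀ {m lo s r b} {occ : Vec Bool m} → PackedFrom lo s r occ → PackedFrom (suc lo) s r (b ∷ occ)

PackedFrom-length : ∀ {m lo s r} {occ : Vec Bool m} → PackedFrom lo s r occ → m ≡ lo + s
PackedFrom-length (here _) = refl
PackedFrom-length (skip p) = cong suc (PackedFrom-length p)

data Arrival {m} (lo s r d : ℕ) (occ : Vec Bool m) : Set where
  parks : (r <ᵇ s) ≡ true → proj₂ (parkAt (lo + d) occ) ≡ true →
          PackedFrom (lo + d) (s ∸ d) (suc (r ∸ d)) (proj₁ (parkAt (lo + d) occ)) → Arrival lo s r d occ
  fails : (r <ᵇ s) ≡ false → proj₂ (parkAt (lo + d) occ) ≡ false →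
          PackedFrom (lo + d) (s ∸ d) (r ∸ d) (proj₁ (parkAt (lo + d) occ)) → Arrival lo s r d occ

arrival-here : ∀ {s r occ} → Packed s r occ → Arrival 0 s r 0 occ
arrival-here []        = fails refl refl (here [])
arrival-here (free p)  = parks refl refl (here (taken p))
arrival-here (taken p) with arrival-here p
... | parks r<s parked (here q) = parks r<s parked (here (taken q))
... | fails r≮s failed (here q) = fails r≮s failed (here (taken q))

arrival-packed : ∀ {s r occ} → Packed s r occ → ∀ d → d < s → Arrival 0 s r d occ
arrival-packed p zero _ = arrival-here p
arrival-packed (free {s} {occ} p) (suc d) (s≤s d<s@(s≤s _)) with arrival-packed p d d<s
... | parks _ parked q =
  parks refl parked (skip (subst (λ x → PackedFrom d (s ∸ d) (suc x) (proj₁ (parkAt d occ))) (0∸n≡0 d) q))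
... | fails () _ _
arrival-packed (taken p) (suc d) (s≤s d<s) with arrival-packed p d d<s
... | parks r<s parked q = parks r<s parked (skip q)
... | fails r≮s failed q = fails r≮s failed (skip q)

arrival : ∀ {m lo s r} {occ : Vec Bool m} → PackedFrom lo s r occ → ∀ d → d < s → Arrival lo s r d occ
arrival (here p) d d<s = arrival-packed p d d<s
arrival (skip p) d d<s with arrival p d d<s
... | parks r<s parked q = parks r<s parked (skip q)
... | fails r≮s failed q = fails r≮s failed (skip q)

headAtLeastᵇ : ∀ {m k} → ℕ → Vec (Fin m) k → Bool
headAtLeastᵇ lo []      = true
headAtLeastᵇ lo (a ∷ _) = lo ≤ᵇ toℕ a

orderedᵇ-∷ : ∀ {m k} (a : Fin m) (v : Vec (Fin m) k) →
  orderedᵇ (a ∷ v) ≡ headAtLeastᵇ (toℕ a) v ∧ orderedᵇ v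
orderedᵇ-∷ a []      = refl
orderedᵇ-∷ a (b ∷ v) = refl

flawsAfterCarAt : ∀ {m k} → Vec Bool m → ℕ → Vec (Fin m) k → ℕ
flawsAfterCarAt occ x v =
  let occ' , parked = parkAt x occ in if parked then flawsFrom occ' v else suc (flawsFrom occ' v)

flawsFrom-∷ : ∀ {m k} (occ : Vec Bool m) a (v : Vec (Fin m) k) →
  flawsFrom occ (a ∷ v) ≡ flawsAfterCarAt occ (toℕ a) v
flawsFrom-∷ occ a v with parkAt (toℕ a) occ
... | occ' , true  = refl
... | occ' , false = refl

orderedRuns : ∀ {m} → ℕ → ℕ → Vec Bool m → (ℕ → Bool) → ℕ
orderedRuns {m} k lo occ p =
  count (λ v → headAtLeastᵇ lo v ∧ (orderedᵇ v ∧ p (flawsFrom occ v))) (allVecs m k)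

orderedRuns≡completions : ∀ k {m lo s r} {occ : Vec Bool m} p →
  PackedFrom lo s r occ → orderedRuns k lo occ p ≡ completions s r k p
orderedRuns≡completions zero p _ with p 0
... | true  = refl
... | false = refl
orderedRuns≡completions (suc k) {m} {lo} {s} {r} {occ} p packed = begin
  orderedRuns (suc k) lo occ p
    ≡⟨ count-allVecs-suc m k _ (λ x → if lo ≤ᵇ x then runsFrom x else 0) byHead ⟩
  sumBelow m (λ x → if lo ≤ᵇ x then runsFrom x else 0)
    ≡⟨ sumBelow-from lo m runsFrom ⟩
  sumBelow (m ∸ lo) (runsFrom ∘ (lo +_))
    ≡⟨ cong (λ n → sumBelow n (runsFrom ∘ (lo +_))) m∸lo≡s ⟩
  sumBelow s (runsFrom ∘ (lo +_))
    ≡⟨ sumBelow-cong s byArrival ⟩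
  completions s r (suc k) p ∎
  where
  runsFrom : ℕ → ℕ
  runsFrom x = count (λ v → headAtLeastᵇ x v ∧ (orderedᵇ v ∧ p (flawsAfterCarAt occ x v))) (allVecs m k)
  byHead : ∀ a → count (λ v → headAtLeastᵇ lo (a ∷ v) ∧ (orderedᵇ (a ∷ v) ∧ p (flawsFrom occ (a ∷ v))))
                       (allVecs m k)
               ≡ (if lo ≤ᵇ toℕ a then runsFrom (toℕ a) else 0)
  byHead a with lo ≤ᵇ toℕ a
  ... | false = count-false (allVecs m k)
  ... | true  = count-cong (λ v → trans (cong₂ (λ b n → b ∧ p n) (orderedᵇ-∷ a v) (flawsFrom-∷ occ a v))
                                         (∧-assoc (headAtLeastᵇ (toℕ a) v) (orderedᵇ v) _))
                           (allVecs m k)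
  m∸lo≡s : m ∸ lo ≡ s
  m∸lo≡s = trans (cong (_∸ lo) (PackedFrom-length packed)) (m+n∸m≡n lo s)
  runsFrom-after : ∀ d {b} → proj₂ (parkAt (lo + d) occ) ≡ b →
    runsFrom (lo + d) ≡ orderedRuns k (lo + d) (proj₁ (parkAt (lo + d) occ)) (λ n → p (if b then n else suc n))
  runsFrom-after d e = count-cong
    (λ v → cong (λ b → headAtLeastᵇ (lo + d) v ∧ (orderedᵇ v ∧ p (if b then flaws' v else suc (flaws' v)))) e)
    (allVecs m k)
    where
    flaws' : Vec (Fin m) k → ℕ
    flaws' = flawsFrom (proj₁ (parkAt (lo + d) occ))
  byArrival : ∀ d → d < s → runsFrom (lo + d) ≡
    (if r <ᵇ s then completions (s ∸ d) (suc (r ∸ d)) k p else completions (s ∸ d) (r ∸ d) k (p ∘ suc))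
  byArrival d d<s with arrival packed d d<s
  ... | parks r<ᵇs parked q rewrite r<ᵇs = trans (runsFrom-after d parked) (orderedRuns≡completions k p q)
  ... | fails r≮ᵇs failed q rewrite r≮ᵇs = trans (runsFrom-after d failed) (orderedRuns≡completions k (p ∘ suc) q)

Packed-empty : ∀ n → Packed n 0 (replicate n false)
Packed-empty zero    = []
Packed-empty (suc n) = free (Packed-empty n)

op≡completions : ∀ n t → op n t ≡ completions n 0 n (λ x → x ≡ᵇ t)
op≡completions n t = trans (count-cong headAtLeast0 (allVecs n n))
  (orderedRuns≡completions n (λ x → x ≡ᵇ t) (here (Packed-empty n)))
  where
  headAtLeast0 : ∀ (v : Vec (Fin n) n) → (orderedᵇ v ∧ (flaws v ≡ᵇ t))
    ≡ (headAtLeastᵇ 0 v ∧ (orderedᵇ v ∧ (flawsFrom (replicate n false) v ≡ᵇ t)))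
  headAtLeast0 []      = refl
  headAtLeast0 (a ∷ v) = refl

indicator-atMost-zero : ∀ x → indicator (atMost 0 x) ≡ indicator (x ≡ᵇ 0) + indicator false
indicator-atMost-zero zero    = refl
indicator-atMost-zero (suc x) = refl

indicator-atMost-suc : ∀ t x → indicator (atMost (suc t) x) ≡ indicator (x ≡ᵇ suc t) + indicator (atMost t x)
indicator-atMost-suc t       zero          = refl
indicator-atMost-suc zero    (suc zero)    = refl
indicator-atMost-suc zero    (suc (suc x)) = refl
indicator-atMost-suc (suc t) (suc x)       = indicator-atMost-suc t x

completions-atMost : ∀ s t → completions (suc s) 0 (suc s) (atMost t) ≡ boundedPaths (suc s) s t
completions-atMost s t = completions-closed s 0 (suc s) t t z≤n refl z≤n

op-zero : ∀ s → op (suc s) 0 ≡ boundedPaths (suc s) s 0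
op-zero s = begin
  op (suc s) 0                                           ≡⟨ op≡completions (suc s) 0 ⟩
  C (_≡ᵇ 0)                                              ≡⟨ +-identityʳ _ ⟨
  C (_≡ᵇ 0) + 0                                          ≡⟨ cong (C (_≡ᵇ 0) +_) (completions-false (suc s) 0 (suc s)) ⟨
  C (_≡ᵇ 0) + C (λ _ → false)                            ≡⟨ completions-split (suc s) 0 (suc s) _ _ _ indicator-atMost-zero ⟨
  C (atMost 0)                                           ≡⟨ completions-atMost s 0 ⟩
  boundedPaths (suc s) s 0                               ∎
  where
  C = completions (suc s) 0 (suc s)

op-suc : ∀ s t → op (suc s) (suc t) + boundedPaths (suc s) s t ≡ boundedPaths (suc s) s (suc t)
op-suc s t = begin
  op (suc s) (suc t) + boundedPaths (suc s) s t          ≡⟨ cong₂ _+_ (op≡completions (suc s) (suc t)) (sym (completions-atMost s t)) ⟩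
  C (_≡ᵇ suc t) + C (atMost t)                           ≡⟨ completions-split (suc s) 0 (suc s) _ _ _ (indicator-atMost-suc t) ⟨
  C (atMost (suc t))                                     ≡⟨ completions-atMost s (suc t) ⟩
  boundedPaths (suc s) s (suc t)                         ∎
  where
  C = completions (suc s) 0 (suc s)

op-last : ∀ t → op (suc t) t ≡ 1
op-last zero    = op-zero 0
op-last (suc t) = +-cancelʳ-≡ B (op n (suc t)) 1 (begin
  op n (suc t) + B                   ≡⟨ op-suc (suc t) t ⟩
  boundedPaths n (suc t) (suc t)     ≡⟨ boundedPaths-unconstrained n (suc t) (suc t) ≤-refl ⟩
  paths n (suc t)                    ≡⟨ subst (λ u → boundedPaths n (suc u) t + 1 ≡ paths n (suc u))
                                              (+-identityʳ t) (reflection n t 0 z≤n) ⟨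
  B + 1                              ≡⟨ +-comm B 1 ⟩
  1 + B                              ∎)
  where
  n = suc (suc t)
  B = boundedPaths n (suc t) t

op-difference : ∀ t i → op (suc (t + suc i)) t + paths (suc (t + suc (t + suc i))) i
                      ≡ paths (t + suc (t + suc i)) (suc i)
op-difference zero    i = trans (cong (_+ paths (suc (suc (suc i))) i) (op-zero (suc i)))
                                (reflection (suc (suc i)) 0 i (≤-trans (n≤1+n i) (n≤1+n (suc i))))
op-difference (suc t) i = +-cancelʳ-≡ B′ _ _ (begin
  op n (suc t) + P₁ + B′                 ≡⟨ +-right-comm (op n (suc t)) P₁ B′ ⟩
  op n (suc t) + B′ + P₁                 ≡⟨ cong (_+ P₁) (op-suc s t) ⟩
  boundedPaths n s (suc t) + P₁          ≡⟨ subst (λ u → boundedPaths n (suc u) (suc t) + P₁ ≡ paths n (suc u))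
                                                  (sym (+-suc t i)) (reflection n (suc t) i (m≤n⇒m≤1+n i≤s)) ⟩
  paths n s                              ≡⟨ reflection n t (suc i) (s≤s i≤s) ⟨
  B′ + P₂                                ≡⟨ +-comm B′ P₂ ⟩
  P₂ + B′                                ∎)
  where
  s  = suc (t + suc i)
  n  = suc s
  B′ = boundedPaths n s t
  P₁ = paths (suc (suc t + n)) i
  P₂ = paths (suc (t + n)) (suc i)
  i≤s : i ≤ s
  i≤s = ≤-trans (n≤1+n i) (m≤n+m (suc i) (suc t))
  +-right-comm : ∀ a b c → a + b + c ≡ a + c + b
  +-right-comm = solve 3 (λ a b c → a :+ b :+ c := a :+ c :+ b) refl

ballot-identity : ∀ t i o X Y → o + Y ≡ X → suc i * X ≡ suc (t + suc (t + suc i)) * Y →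
                  suc (t + suc i) * o ≡ (t + 1) * (X + Y)
ballot-identity t i o X Y o+Y≡X absorb = +-cancelʳ-≡ (n * Y) (n * o) ((t + 1) * (X + Y)) (begin
  n * o + n * Y                         ≡⟨ *-distribˡ-+ n o Y ⟨
  n * (o + Y)                           ≡⟨ cong (n *_) o+Y≡X ⟩
  n * X                                 ≡⟨ solve 3 (λ t i X → (con 1 :+ (t :+ (con 1 :+ i))) :* X
                                                      := (t :+ con 1) :* X :+ (con 1 :+ i) :* X) refl t i X ⟩
  (t + 1) * X + suc i * X               ≡⟨ cong ((t + 1) * X +_) absorb ⟩
  (t + 1) * X + suc (t + n) * Y         ≡⟨ solve 4 (λ t i X Y → (t :+ con 1) :* X :+ (con 1 :+ (t :+ (con 1 :+ (t :+ (con 1 :+ i))))) :* Y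
                                                      := (t :+ con 1) :* (X :+ Y) :+ (con 1 :+ (t :+ (con 1 :+ i))) :* Y) refl t i X Y ⟩
  (t + 1) * (X + Y) + n * Y             ∎)
  where
  n = suc (t + suc i)

[1+t+x]∸t∸1≡x : ∀ t x → suc (t + x) ∸ t ∸ 1 ≡ x
[1+t+x]∸t∸1≡x zero    x = refl
[1+t+x]∸t∸1≡x (suc t) x = [1+t+x]∸t∸1≡x t x

op-formula : ∀ t i → let n = suc (t + suc i) in n * op n t ≡ (t + 1) * ((n + n) C suc i)
op-formula t i = begin
  n * op n t                                ≡⟨ ballot-identity t i (op n t) _ _ (op-difference t i) (paths-absorb (t + n) i) ⟩
  (t + 1) * paths (suc (t + n)) (suc i)     ≡⟨ cong ((t + 1) *_) (paths≡C (suc (t + n)) (suc i)) ⟩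
  (t + 1) * ((suc (t + n) + suc i) C suc i) ≡⟨ cong (λ m → (t + 1) * (m C suc i)) n+n ⟩
  (t + 1) * ((n + n) C suc i)               ∎
  where
  n = suc (t + suc i)
  n+n : suc (t + n) + suc i ≡ n + n
  n+n = solve 2 (λ t i → con 1 :+ (t :+ (con 1 :+ (t :+ (con 1 :+ i)))) :+ (con 1 :+ i)
                       := (con 1 :+ (t :+ (con 1 :+ i))) :+ (con 1 :+ (t :+ (con 1 :+ i)))) refl t i

mainTheorem4 : (n k : ℕ) → 1 ≤ n → k < n →
    n * op n k ≡ (k + 1) * ((n + n) C (n ∸ k ∸ 1))
mainTheorem4 n k _ k<n with m≤n⇒∃[o]m+o≡n k<n
... | zero  , refl rewrite [1+t+x]∸t∸1≡x k 0 | +-identityʳ k | op-last k = cong (_* 1) (+-comm 1 k)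
... | suc i , refl rewrite [1+t+x]∸t∸1≡x k (suc i) = op-formula k i
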